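{- Let $\psi\in\mathcal M$, let $\mathbf u$ be a fixed point of $\psi$, and let $w=N(\psi)$ be the normalized name of $\psi$. If either (i) $\mathbf u$ starts with $0$ and $w$ starts with $a$, or (ii) $\mathbf u$ starts with $1$ and $w$ starts with $\alpha$, then $w\in\{a,\alpha\}^*$.
   Context: Let $\varphi_a:0\mapsto 0,1\mapsto 10$; $\varphi_b:0\mapsto0,1\mapsto 01$; $\varphi_\alpha:0\mapsto 01,1\mapsto 1$; $\varphi_\beta:0\mapsto 10,1\mapsto 1$. For a nonempty word $u=u_0\cdots u_{n-1}$ over $\{a,b,\alpha,\beta\}$ put $\varphi_u=\varphi_{u_0}\circ\cdots\circ\varphi_{u_{n-1}}$; $\mathcal M$ is the monoid generated by $\varphi_a,\varphi_b,\varphi_\alpha,\varphi_\beta$. It is known that $\varphi_w=\varphi_v$ iff $v$ is obtained from $w$ by the rewriting rules $\alpha a^k\beta=\beta b^k\alpha$, $a\alpha^kb=b\beta^ka$ ($k\in\mathbb N$), which preserve positions of Latin letters $a,b$ and Greek letters $\alpha,\beta$. With $a<b$, $\alpha<\beta$, the normalized name $N(w)$ is the lexicographically greatest word obtainable from $w$ by these rules, and $N(\psi)=N(w)$ for any $w$ with $\psi=\varphi_w$. A fixed point of $\psi$ is an infinite word $\mathbf u$ with $\psi(\mathbf u)=\mathbf u$. -}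

module Defs where

open import Data.Nat using (ℕ; zero; suc)
open import Data.List using (List; []; _∷_; _++_; concatMap; upTo; replicate)
open import Data.Product using (_×_; ∃; ∃-syntax; _,_)
open import Data.Sum using (_⊎_)
open import Relation.Binary.PropositionalEquality using (_≡_)
open import Relation.Binary.Construct.Closure.ReflexiveTransitive using (Star)

data Bit : Set where
  𝟎 𝟏 : Bit

data Gen : Set where
  a b α β : Gen

φ : Gen → Bit → List Bit
φ a 𝟎 = 𝟎 ∷ []
φ a 𝟏 = 𝟏 ∷ 𝟎 ∷ []
φ b 𝟎 = 𝟎 ∷ []
φ b 𝟏 = 𝟎 ∷ 𝟏 ∷ []
φ α 𝟎 = 𝟎 ∷ 𝟏 ∷ []
φ α 𝟏 = 𝟏 ∷ []
φ β 𝟎 = 𝟏 ∷ 𝟎 ∷ []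
φ β 𝟏 = 𝟏 ∷ []

φ* : Gen → List Bit → List Bit
φ* g = concatMap (φ g)

-- φ_u applied to a finite word: φ_{u0} ∘ φ_{u1} ∘ ⋯ ∘ φ_{u(n-1)}
-- (the empty word gives the identity; the theorem only uses nonempty u)
applyW : List Gen → List Bit → List Bit
applyW [] x = x
applyW (g ∷ u) x = φ* g (applyW u x)

img : List Gen → Bit → List Bit
img u c = applyW u (c ∷ [])

lookupD : {A : Set} → A → List A → ℕ → A
lookupD d [] n = d
lookupD d (x ∷ xs) zero = x
lookupD d (x ∷ xs) (suc n) = lookupD d xs n

InfWord : Set
InfWord = ℕ → Bit

-- Since all morphisms in M are
-- non-erasing, position n lies in the first n+1 blocks, so the
-- default value is never used.
imgInf : List Gen → InfWord → InfWord
imgInf u x n = lookupD 𝟎 (concatMap (λ i → img u (x i)) (upTo (suc n))) n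

IsFixedPoint : List Gen → InfWord → Set
IsFixedPoint u x = ∀ n → imgInf u x n ≡ x n

data Rule : List Gen → List Gen → Set where
  rule₁ : ∀ k → Rule (α ∷ replicate k a ++ β ∷ []) (β ∷ replicate k b ++ α ∷ [])
  rule₂ : ∀ k → Rule (a ∷ replicate k α ++ b ∷ []) (b ∷ replicate k β ++ a ∷ [])

data Step : List Gen → List Gen → Set where
  step : ∀ x y l r → (Rule l r ⊎ Rule r l) → Step (x ++ l ++ y) (x ++ r ++ y)

_≈R_ : List Gen → List Gen → Set
_≈R_ = Star Step

data _<G_ : Gen → Gen → Set where
  a<b : a <G b
  α<β : α <G β

data _<L_ : List Gen → List Gen → Set where
  halt  : ∀ {h ys} → [] <L (h ∷ ys)
  here  : ∀ {g h xs ys} → g <G h → (g ∷ xs) <L (h ∷ ys)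
  there : ∀ {g xs ys} → xs <L ys → (g ∷ xs) <L (g ∷ ys)

_≤L_ : List Gen → List Gen → Set
x ≤L y = x ≡ y ⊎ x <L y

IsNormalizedName : List Gen → List Gen → Set
IsNormalizedName v w = (v ≈R w) × (∀ w' → v ≈R w' → w' ≤L w)

module Submission where

-- The first letter of φ_v(c) depends only on c and v, via the
-- map  first v : Bit → Bit  obtained by composing the first-letter maps of the
-- generators (a, α: identity; b: constant 0; β: constant 1).  Both sides of
-- each rewriting rule have the same first-letter map, so it is an invariant of
-- the rewriting class, and a fixed point u of φ_v satisfies first v (u 0) = u 0.
-- Hence the normalized name w satisfies first w c = c for c = u 0.
--
-- On the other hand w is lexicographically maximal, so it is locally maximal:
-- no single rule step increases it.  Every rule, read left to right, increases
-- a word, so w contains no left-hand side  α a^k β  or  a α^k b.  Scanning w from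
-- its first letter a (case i), a letter b would complete a redex a α^k b, and a
-- letter β would make the first-letter map of the remaining suffix constant 1,
-- contradicting first w 0 = 0.  Case (ii) is the mirror image with α, a, β, 1.

open import Defs
open import Data.Nat using (ℕ; zero; suc)
open import Data.List using (List; []; _∷_; _++_; replicate)
open import Data.List.Properties using (++-assoc)
open import Data.List.Relation.Unary.All using (All; []; _∷_)
open import Data.Product using (_×_; ∃; ∃-syntax; _,_)
open import Data.Sum using (_⊎_; inj₁; inj₂)
open import Data.Empty using (⊥; ⊥-elim)
open import Function using (_∘_)
open import Relation.Binary.PropositionalEquality
  using (_≡_; _≢_; refl; sym; trans; cong; subst; module ≡-Reasoning)
open import Relation.Binary.Construct.Closure.ReflexiveTransitive using (ε; _◅_; _◅◅_)

firstLetter : Gen → Bit → Bit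
firstLetter a c = c
firstLetter b c = 𝟎
firstLetter α c = c
firstLetter β c = 𝟏

first : List Gen → Bit → Bit
first [] c = c
first (g ∷ v) c = firstLetter g (first v c)

first-++ : ∀ x y c → first (x ++ y) c ≡ first x (first y c)
first-++ [] y c = refl
first-++ (g ∷ x) y c = cong (firstLetter g) (first-++ x y c)

-- a^k β has constant first letter 1 and α^k b constant first letter 0; since a, α
-- act as the identity, both sides of each rule have the same constant map.
first-aᵏβ : ∀ k c → first (replicate k a ++ β ∷ []) c ≡ 𝟏
first-aᵏβ zero c = refl
first-aᵏβ (suc k) c = first-aᵏβ k c

first-αᵏb : ∀ k c → first (replicate k α ++ b ∷ []) c ≡ 𝟎
first-αᵏb zero c = refl
first-αᵏb (suc k) c = first-αᵏb k c

first-rule : ∀ {l r} → Rule l r → ∀ c → first l c ≡ first r c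
first-rule (rule₁ k) c = first-aᵏβ k c
first-rule (rule₂ k) c = first-αᵏb k c

first-context : ∀ x y {l r} → (∀ c → first l c ≡ first r c)
              → ∀ c → first (x ++ l ++ y) c ≡ first (x ++ r ++ y) c
first-context x y {l} {r} l≗r c = begin
  first (x ++ l ++ y) c    ≡⟨ first-++ x (l ++ y) c ⟩
  first x (first (l ++ y) c) ≡⟨ cong (first x) (first-++ l y c) ⟩
  first x (first l (first y c)) ≡⟨ cong (first x) (l≗r (first y c)) ⟩
  first x (first r (first y c)) ≡⟨ cong (first x) (sym (first-++ r y c)) ⟩
  first x (first (r ++ y) c) ≡⟨ sym (first-++ x (r ++ y) c) ⟩
  first (x ++ r ++ y) c    ∎
  where open ≡-Reasoning

first-step : ∀ {v w} → Step v w → ∀ c → first v c ≡ first w c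
first-step (step x y l r (inj₁ l→r)) = first-context x y (first-rule l→r)
first-step (step x y l r (inj₂ r→l)) = first-context x y (sym ∘ first-rule r→l)

first-≈R : ∀ {v w} → v ≈R w → ∀ c → first v c ≡ first w c
first-≈R ε c = refl
first-≈R (s ◅ ss) c = trans (first-step s c) (first-≈R ss c)

applyW-head : ∀ v c xs → ∃[ ys ] applyW v (c ∷ xs) ≡ first v c ∷ ys
applyW-head [] c xs = xs , refl
applyW-head (g ∷ v) c xs with applyW-head v c xs
... | ys , eq rewrite eq = φ*-head g (first v c) ys
  where
  φ*-head : ∀ g d rest → ∃[ ds ] φ* g (d ∷ rest) ≡ firstLetter g d ∷ ds
  φ*-head a 𝟎 rest = _ , refl
  φ*-head a 𝟏 rest = _ , refl
  φ*-head b 𝟎 rest = _ , refl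
  φ*-head b 𝟏 rest = _ , refl
  φ*-head α 𝟎 rest = _ , refl
  φ*-head α 𝟏 rest = _ , refl
  φ*-head β 𝟎 rest = _ , refl
  φ*-head β 𝟏 rest = _ , refl

fixedPoint-first : ∀ v u → IsFixedPoint v u → first v (u 0) ≡ u 0
fixedPoint-first v u fix with applyW-head v (u 0) [] | fix 0
... | ys , eq | u₀-fixed rewrite eq = u₀-fixed

<L-asym : ∀ {x y} → x <L y → y <L x → ⊥
<L-asym (here a<b) (here ())
<L-asym (here α<β) (here ())
<L-asym (there p) (there q) = <L-asym p q

LocallyMaximal : List Gen → Set
LocallyMaximal w = ∀ w' → Step w w' → w <L w' → ⊥

normalizedName-locallyMaximal : ∀ v w → IsNormalizedName v w → LocallyMaximal w
normalizedName-locallyMaximal v w (v≈w , greatest) w' w→w' w<w'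
  with greatest w' (v≈w ◅◅ (w→w' ◅ ε))
... | inj₁ refl = <L-asym w<w' w<w'
... | inj₂ w'<w = <L-asym w<w' w'<w

-- Applying a rule left to right increases a word: the first letter of the
-- redex grows (α to β, resp. a to b).
rule-increases : ∀ {l r} → Rule l r → ∀ p y → (p ++ l ++ y) <L (p ++ r ++ y)
rule-increases (rule₁ k) [] y = here α<β
rule-increases (rule₂ k) [] y = here a<b
rule-increases l→r (g ∷ p) y = there (rule-increases l→r p y)

locallyMaximal-noRedex : ∀ p y {l r} → Rule l r → LocallyMaximal (p ++ l ++ y) → ⊥
locallyMaximal-noRedex p y {l} {r} l→r max =
  max (p ++ r ++ y) (step p y l r (inj₁ l→r)) (rule-increases l→r p y)

replicate-snoc : ∀ {A : Set} k (x : A) r → replicate k x ++ x ∷ r ≡ x ∷ replicate k x ++ r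
replicate-snoc zero x r = refl
replicate-snoc (suc k) x r = cong (x ∷_) (replicate-snoc k x r)

expose : ∀ p x y k z (r : List Gen)
       → p ++ (x ∷ replicate k y ++ z ∷ []) ++ r ≡ p ++ x ∷ replicate k y ++ z ∷ r
expose p x y k z r = cong (λ s → p ++ x ∷ s) (++-assoc (replicate k y) (z ∷ []) r)

Positive : Gen → Set
Positive g = g ≡ a ⊎ g ≡ α

suffixAfter-a : ∀ p k r → LocallyMaximal (p ++ a ∷ replicate k α ++ r)
              → first r 𝟎 ≡ 𝟎 → All Positive r
suffixAfter-a p k [] max fix = []
suffixAfter-a p k (a ∷ r) max fix = inj₁ refl ∷ suffixAfter-a (p ++ a ∷ replicate k α) 0 r
  (subst LocallyMaximal (sym (++-assoc p (a ∷ replicate k α) (a ∷ r))) max) fix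
suffixAfter-a p k (α ∷ r) max fix = inj₂ refl ∷ suffixAfter-a p (suc k) r
  (subst LocallyMaximal (cong (λ s → p ++ a ∷ s) (replicate-snoc k α r)) max) fix
suffixAfter-a p k (b ∷ r) max fix = ⊥-elim (locallyMaximal-noRedex p r (rule₂ k)
  (subst LocallyMaximal (sym (expose p a α k b r)) max))
suffixAfter-a p k (β ∷ r) max ()

suffixAfter-α : ∀ p k r → LocallyMaximal (p ++ α ∷ replicate k a ++ r)
              → first r 𝟏 ≡ 𝟏 → All Positive r
suffixAfter-α p k [] max fix = []
suffixAfter-α p k (α ∷ r) max fix = inj₂ refl ∷ suffixAfter-α (p ++ α ∷ replicate k a) 0 r
  (subst LocallyMaximal (sym (++-assoc p (α ∷ replicate k a) (α ∷ r))) max) fix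
suffixAfter-α p k (a ∷ r) max fix = inj₁ refl ∷ suffixAfter-α p (suc k) r
  (subst LocallyMaximal (cong (λ s → p ++ α ∷ s) (replicate-snoc k a r)) max) fix
suffixAfter-α p k (β ∷ r) max fix = ⊥-elim (locallyMaximal-noRedex p r (rule₁ k)
  (subst LocallyMaximal (sym (expose p α a k β r)) max))
suffixAfter-α p k (b ∷ r) max ()

-- The normalized name has the same first-letter map as ψ, so it fixes u 0.
normalizedName-fixes-u₀ : ∀ v u → IsFixedPoint v u → ∀ w → IsNormalizedName v w
                        → ∀ c → u 0 ≡ c → first w c ≡ c
normalizedName-fixes-u₀ v u fix w (v≈w , _) c refl =
  trans (sym (first-≈R v≈w (u 0))) (fixedPoint-first v u fix)

mainTheorem9 : (v : List Gen) → v ≢ [] → (u : InfWord) → IsFixedPoint v u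
    → (w : List Gen) → IsNormalizedName v w
    → ((u 0 ≡ 𝟎 × ∃[ w' ] w ≡ a ∷ w') ⊎ (u 0 ≡ 𝟏 × ∃[ w' ] w ≡ α ∷ w'))
    → All (λ g → g ≡ a ⊎ g ≡ α) w
mainTheorem9 v _ u fix w name (inj₁ (u₀≡0 , w' , refl)) =
  inj₁ refl ∷ suffixAfter-a [] 0 w'
    (normalizedName-locallyMaximal v w name)
    (normalizedName-fixes-u₀ v u fix w name 𝟎 u₀≡0)
mainTheorem9 v _ u fix w name (inj₂ (u₀≡1 , w' , refl)) =
  inj₂ refl ∷ suffixAfter-α [] 0 w'
    (normalizedName-locallyMaximal v w name)
    (normalizedName-fixes-u₀ v u fix w name 𝟏 u₀≡1)
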